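{- Let $k_1,k_2,k_3\in\mathbb{Z}_{\geq 0}$ and let $(x,y,z)=(a,b,c)$ be a nonsingular positive integer solution of \[x^2+y^2+z^2+k_1xy+k_2yz+k_3zx=(3+k_1+k_2+k_3)xyz\] with $a>b>c$. Then (1) $\frac{a^2+k_3ac+c^2}{b}>a$; (2) $\frac{a^2+k_1ab+b^2}{c}>a$; (3) $b>\frac{b^2+k_2bc+c^2}{a}$.
   Context: A positive integer solution of the equation is called singular if it is one of $(1,1,1)$, $(k_2+2,1,1)$, $(1,k_3+2,1)$, $(1,1,k_1+2)$, and nonsingular otherwise. -}

module Defs where

open import Data.Nat using (ℕ; _+_; _*_; _<_; _≤_)
open import Data.Product using (_×_)
open import Data.Sum using (_⊎_)
open import Relation.Binary.PropositionalEquality using (_≡_)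
open import Relation.Nullary using (¬_)

IsSolution : (k₁ k₂ k₃ x y z : ℕ) → Set
IsSolution k₁ k₂ k₃ x y z =
  x * x + y * y + z * z + k₁ * x * y + k₂ * y * z + k₃ * z * x
    ≡ (3 + k₁ + k₂ + k₃) * x * y * z

IsPosSolution : (k₁ k₂ k₃ x y z : ℕ) → Set
IsPosSolution k₁ k₂ k₃ x y z =
  (1 ≤ x) × (1 ≤ y) × (1 ≤ z) × IsSolution k₁ k₂ k₃ x y z

Singular : (k₁ k₂ k₃ x y z : ℕ) → Set
Singular k₁ k₂ k₃ x y z =
    (x ≡ 1 × y ≡ 1 × z ≡ 1)
  ⊎ (x ≡ k₂ + 2 × y ≡ 1 × z ≡ 1)
  ⊎ (x ≡ 1 × y ≡ k₃ + 2 × z ≡ 1)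
  ⊎ (x ≡ 1 × y ≡ 1 × z ≡ k₁ + 2)

NonsingularPosSolution : (k₁ k₂ k₃ x y z : ℕ) → Set
NonsingularPosSolution k₁ k₂ k₃ x y z =
  IsPosSolution k₁ k₂ k₃ x y z × ¬ Singular k₁ k₂ k₃ x y z

{-# OPTIONS --safe #-}
-- For fixed b and c the equation is the quadratic  x² + L x + P = T x  in x, with
-- L = k₁b + k₃c, P = b² + k₂bc + c² and T = (3+k₁+k₂+k₃)bc, and a is one of its roots.
-- Since b > c ≥ 1 the quadratic is negative at x = b, so b lies strictly between its two
-- roots and the other root P/a is smaller than b; this is (3).  Parts (1) and (2) only
-- use that a is the largest coordinate.
module Submission where

open import Defs
open import Data.Nat using (ℕ; _+_; _*_; _∸_; _<_; _>_; _≤_; z≤n; >-nonZero)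
open import Data.Nat.Properties
open import Data.Nat.Tactic.RingSolver using (solve-∀)
open import Data.Product using (_×_; _,_)
open import Relation.Binary.PropositionalEquality using (_≡_; sym; trans; cong; subst; subst₂; module ≡-Reasoning)

isSolution⇒quadratic-in-x : ∀ k₁ k₂ k₃ a b c → IsSolution k₁ k₂ k₃ a b c →
  a * a + (b * b + k₂ * b * c + c * c) + a * (k₁ * b + k₃ * c)
    ≡ a * ((3 + k₁ + k₂ + k₃) * b * c)
isSolution⇒quadratic-in-x k₁ k₂ k₃ a b c sol =
  trans (regroup k₁ k₂ k₃ a b c) (trans sol (reassociate k₁ k₂ k₃ a b c))
  where
  regroup : ∀ k₁ k₂ k₃ a b c →
    a * a + (b * b + k₂ * b * c + c * c) + a * (k₁ * b + k₃ * c)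
      ≡ a * a + b * b + c * c + k₁ * a * b + k₂ * b * c + k₃ * c * a
  regroup = solve-∀
  reassociate : ∀ k₁ k₂ k₃ a b c →
    (3 + k₁ + k₂ + k₃) * a * b * c ≡ a * ((3 + k₁ + k₂ + k₃) * b * c)
  reassociate = solve-∀

quadratic-in-x-negative-at-b : ∀ k₁ k₂ k₃ {b c} → 1 ≤ c → c < b →
  b * b + (b * b + k₂ * b * c + c * c) + b * (k₁ * b + k₃ * c)
    < b * ((3 + k₁ + k₂ + k₃) * b * c)
quadratic-in-x-negative-at-b k₁ k₂ k₃ {b} {c} 1≤c c<b =
  subst₂ _<_ (sym (expand-value k₁ k₂ k₃ b c)) (sym (expand-bound k₁ k₂ k₃ b c)) termwise
  where
  instance
    _ = >-nonZero 1≤c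
    _ = >-nonZero (≤-trans 1≤c (<⇒≤ c<b))
  expand-value : ∀ k₁ k₂ k₃ b c →
    b * b + (b * b + k₂ * b * c + c * c) + b * (k₁ * b + k₃ * c)
      ≡ (2 + k₁) * (b * b) + (k₂ + k₃) * (b * c) + c * c
  expand-value = solve-∀
  expand-bound : ∀ k₁ k₂ k₃ b c →
    b * ((3 + k₁ + k₂ + k₃) * b * c)
      ≡ (2 + k₁) * (b * b * c) + (k₂ + k₃) * (b * b * c) + b * b * c
  expand-bound = solve-∀
  bc≤bbc : b * c ≤ b * b * c
  bc≤bbc = *-monoˡ-≤ c (m≤m*n b b)
  termwise : (2 + k₁) * (b * b) + (k₂ + k₃) * (b * c) + c * c
           < (2 + k₁) * (b * b * c) + (k₂ + k₃) * (b * b * c) + b * b * c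
  termwise = +-mono-≤-<
    (+-mono-≤ (*-monoʳ-≤ (2 + k₁) (m≤m*n (b * b) c)) (*-monoʳ-≤ (k₂ + k₃) bc≤bbc))
    (<-≤-trans (*-monoˡ-< c c<b) bc≤bbc)

-- With f(x) = x² + Lx + P − Tx, comparing b·f(a) = 0 with a·f(b) < 0 leaves
-- (a − b)·P < (a − b)·ab.
other-root-below : ∀ {a b} P L T → b < a →
  a * a + P + a * L ≡ a * T →
  b * b + P + b * L < b * T →
  P < b * a
other-root-below {a} {b} P L T b<a root-at-a negative-at-b =
  subst (λ x → P < b * x) b+e≡a
    (*-cancelˡ-< e P (b * (b + e))
      (+-cancelˡ-< common (e * P) (e * (b * (b + e)))
        (subst₂ _<_ (expand-left b e P L) (expand-right b e P L)
          (subst (λ x → x * (b * b + P + b * L) < b * (x * x + P + x * L)) (sym b+e≡a)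
            cross-multiplied))))
  where
  open ≡-Reasoning
  instance _ = >-nonZero (≤-<-trans z≤n b<a)
  e : ℕ
  e = a ∸ b
  b+e≡a : b + e ≡ a
  b+e≡a = m+[n∸m]≡n (<⇒≤ b<a)
  common : ℕ
  common = b * (b * b) + b * P + b * (b * L) + e * (b * L) + e * (b * b)
  cross-multiplied : a * (b * b + P + b * L) < b * (a * a + P + a * L)
  cross-multiplied = <-≤-trans (*-monoʳ-< a negative-at-b) (≤-reflexive (begin
    a * (b * T)               ≡⟨ *-comm a (b * T) ⟩
    b * T * a                 ≡⟨ *-assoc b T a ⟩
    b * (T * a)               ≡⟨ cong (b *_) (*-comm T a) ⟩
    b * (a * T)               ≡⟨ cong (b *_) (sym root-at-a) ⟩
    b * (a * a + P + a * L)   ∎))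
  expand-left : ∀ b e P L → (b + e) * (b * b + P + b * L)
    ≡ b * (b * b) + b * P + b * (b * L) + e * (b * L) + e * (b * b) + e * P
  expand-left = solve-∀
  expand-right : ∀ b e P L → b * ((b + e) * (b + e) + P + (b + e) * L)
    ≡ b * (b * b) + b * P + b * (b * L) + e * (b * L) + e * (b * b) + e * (b * (b + e))
  expand-right = solve-∀

proposition2p3 : (k₁ k₂ k₃ a b c : ℕ) →
    NonsingularPosSolution k₁ k₂ k₃ a b c →
    a > b → b > c →
    (a * b < a * a + k₃ * a * c + c * c)
    × (a * c < a * a + k₁ * a * b + b * b)
    × (b * b + k₂ * b * c + c * c < b * a)
proposition2p3 k₁ k₂ k₃ a b c ((_ , _ , 1≤c , sol) , _) a>b b>c =
    <-≤-trans (a*b<a*a a>b) (≤-trans (m≤m+n _ _) (m≤m+n _ _))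
  , <-≤-trans (a*b<a*a (<-trans b>c a>b)) (≤-trans (m≤m+n _ _) (m≤m+n _ _))
  , other-root-below _ _ _ a>b
      (isSolution⇒quadratic-in-x k₁ k₂ k₃ a b c sol)
      (quadratic-in-x-negative-at-b k₁ k₂ k₃ 1≤c b>c)
  where
  instance _ = >-nonZero (≤-<-trans z≤n a>b)
  a*b<a*a : ∀ {y} → y < a → a * y < a * a
  a*b<a*a = *-monoʳ-< a
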